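{- Suppose $P_I(\mathbf{x})=0$ for all $I\in\{1,2,\dots,9,11,12\}$. Let $(u_i,u_l)\in E(\mathcal{T})$. Then there exists an edge of $\mathcal{N}$ from the terminal vertex of the directed path induced by $d(\mathbf{x},u_i)$ to a vertex of the directed path induced by $d(\mathbf{x},u_l)$.
   Context: $\mathcal{N}$ is a rooted binary phylogenetic network on a finite set $X$ with vertices $v_0,\dots,v_{n_{\mathcal{N}}-1}$. That is, $\mathcal{N}$ is an acyclic digraph without parallel edges with a unique root (in-degree 0, out-degree 2, reaching all vertices), leaves of in-degree 1 forming $X$, and other vertices of in/out-degree $(1,2)$ or $(2,1)$. $\mathcal{T}$ is a rooted binary phylogenetic $X$-tree (no in-degree-2 vertices) with vertices $u_0,\dots,u_{n_{\mathcal{T}}-1}$, where $u_0$ is its root; $u_{n_{\mathcal{T}}}$ is an extra symbol. Assume $n_{\mathcal{N}}\ge n_{\mathcal{T}}$, and let $s=1+\lfloor\log_2(n_{\mathcal{N}}-n_{\mathcal{T}})\rfloor$ if $n_{\mathcal{N}}>n_{\mathcal{T}}$ and $s=0$ otherwise. Tree vertices have out-degree 2, with children $v_{j_1},v_{j_2}$. Reticulation vertices have in-degree 2, with parents $v_{j^1},v_{j^2}$. $f(u_i,u_l)=1$ iff $(u_i,u_l)\in E(\mathcal{T})$, and $g(v_j,v_k)=1$ iff $(v_j,v_k)\in E(\mathcal{N})$. The binary variables are: - $x_{i,j}$ for $0\le i\le n_{\mathcal{T}}$, $0\le j<n_{\mathcal{N}}$; - $y_{i,r}$ for $1\le i\le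 n_{\mathcal{T}}-1$, $0\le r<s$; - $z_{i,j}$ for $i<n_{\mathcal{T}}$ and $v_j$ a tree or reticulation vertex; - $\hat z_{i,2j},\hat z_{i,2j+1}$ for non-leaf $u_i$ and tree $v_j$. $d(\mathbf{x},u_i)=\{v_j:x_{i,j}=1\}$. With $i,l\in\{0,\dots,n_{\mathcal{T}}-1\}$ and $j,k\in\{0,\dots,n_{\mathcal{N}}-1\}$: - $P_1=(1-\sum_jx_{0,j})^2+\sum_{i=1}^{n_{\mathcal{T}}-1}(1-\sum_jx_{i,j}+\sum_{r=0}^{s-1}2^ry_{i,r})^2$; - $P_2=\sum_j(\sum_{i=0}^{n_{\mathcal{T}}}x_{i,j}-1)^2$; - $P_3=\sum_i\sum_{\text{tree }v_j}(x_{i,j_1}x_{i,j_2}-2x_{i,j_1}z_{i,j}-2x_{i,j_2}z_{i,j}+3z_{i,j})$; - $P_4=\sum_i\sum_{\text{tree }v_j}x_{i,j}z_{i,j}$; - $P_5=\sum_i\sum_{\text{ret. }v_j}(x_{i,j^1}x_{i,j^2}-2x_{i,j^1}z_{i,j}-2x_{i,j^2}z_{i,j}+3z_{i,j})$; - $P_6=\sum_i\sum_{\text{ret. }v_j}x_{i,j}z_{i,j}$; - $P_7=\sum_i\sum_{l\ne i}f(u_i,u_l)\sum_{\text{tree }v_j}x_{i,j}z_{l,j}$; - $P_8=\sum_{u_i\text{ non-leaf}}\sum_{\text{tree }v_j}(x_{i,j}x_{i,j_1}-2x_{i,j}\hat z_{i,2j}-2x_{i,j_1}\hat z_{i,2j}+3\hat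 z_{i,2j}+x_{i,j}x_{i,j_2}-2x_{i,j}\hat z_{i,2j+1}-2x_{i,j_2}\hat z_{i,2j+1}+3\hat z_{i,2j+1})$; - $P_9=\sum_i\sum_{l\ne i}f(u_i,u_l)\sum_{\text{tree }v_j}(\hat z_{i,2j}x_{l,j_2}+\hat z_{i,2j+1}x_{l,j_1})$; - $P_{11}=\sum_i\sum_jx_{i,j}(1-\sum_{k\ne j}g(v_j,v_k)x_{i,k})-n_{\mathcal{T}}$; - $P_{12}=\sum_i\sum_{l\ne i}f(u_i,u_l)(1-\sum_j\sum_{k\ne j}g(v_j,v_k)x_{i,j}x_{l,k})$. Under these hypotheses each $d(\mathbf{x},u_i)$ induces a directed path in $\mathcal{N}$; its terminal vertex is its last vertex. -}

module Defs where

open import Data.Bool using (Bool; true; false; if_then_else_; _∧_; not)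
open import Data.Nat as ℕ using (ℕ; zero; suc; _∸_; _≡ᵇ_; _^_)
open import Data.Nat.Logarithm using (⌊log₂_⌋)
open import Data.Fin using (Fin; zero; suc; inject₁; fromℕ; toℕ; _≟_)
open import Data.Integer using (ℤ; +_; _+_; _-_; _*_)
open import Data.List using (List; []; _∷_; filterᵇ; allFin)
open import Data.Product using (Σ; _×_; ∃)
open import Data.Sum using (_⊎_)
open import Relation.Nullary using (¬_; does)
open import Relation.Binary.PropositionalEquality using (_≡_)

ΣF : (n : ℕ) → (Fin n → ℤ) → ℤ
ΣF zero    h = + 0
ΣF (suc n) h = h zero + ΣF n (λ k → h (suc k))

count : (n : ℕ) → (Fin n → Bool) → ℕ
count zero    b = 0
count (suc n) b = (if b zero then 1 else 0) ℕ.+ count n (λ k → b (suc k))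

bz : Bool → ℤ
bz true  = + 1
bz false = + 0

sq : ℤ → ℤ
sq a = a * a

-- the term w if i ≠ l, and 0 if i = l   (realises "sum over l ≠ i")
offDiag : ∀ {n} → Fin n → Fin n → ℤ → ℤ
offDiag i l w = if does (i ≟ l) then + 0 else w

-- Digraphs on vertex set Fin n, given by their edge indicator
-- (g u v = true iff (u,v) is an edge; no parallel edges by construction)

Digraph : ℕ → Set
Digraph n = Fin n → Fin n → Bool

outdeg : ∀ {n} → Digraph n → Fin n → ℕ
outdeg {n} g v = count n (λ w → g v w)

indeg : ∀ {n} → Digraph n → Fin n → ℕ
indeg {n} g v = count n (λ u → g u v)

data Reach⁺ {n} (g : Digraph n) : Fin n → Fin n → Set where
  edge : ∀ {u v} → g u v ≡ true → Reach⁺ g u v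
  cons : ∀ {u v w} → g u v ≡ true → Reach⁺ g v w → Reach⁺ g u w

Reaches : ∀ {n} → Digraph n → Fin n → Fin n → Set
Reaches g u v = u ≡ v ⊎ Reach⁺ g u v

Acyclic : ∀ {n} → Digraph n → Set
Acyclic {n} g = (v : Fin n) → ¬ Reach⁺ g v v

IsRootV : ∀ {n} → Digraph n → Fin n → Set
IsRootV g v = indeg g v ≡ 0 × outdeg g v ≡ 2

IsLeafV : ∀ {n} → Digraph n → Fin n → Set
IsLeafV g v = indeg g v ≡ 1 × outdeg g v ≡ 0

IsInnerTreeV : ∀ {n} → Digraph n → Fin n → Set
IsInnerTreeV g v = indeg g v ≡ 1 × outdeg g v ≡ 2

IsReticulationV : ∀ {n} → Digraph n → Fin n → Set
IsReticulationV g v = indeg g v ≡ 2 × outdeg g v ≡ 1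

-- rooted binary phylogenetic network (unlabelled part): acyclic, a root
-- (in 0, out 2) reaching every vertex, all other vertices are leaves
-- (in 1, out 0), (1,2)- or (2,1)-vertices; hence the root is unique.
IsRootedBinaryNetwork : ∀ {n} → Digraph n → Set
IsRootedBinaryNetwork {n} g =
  Acyclic g ×
  Σ (Fin n) (λ r → IsRootV g r × ((v : Fin n) → Reaches g r v) ×
     ((v : Fin n) → v ≡ r ⊎ IsLeafV g v ⊎ IsInnerTreeV g v ⊎ IsReticulationV g v))

IsRootedBinaryTree : ∀ {t} → Digraph (suc t) → Set
IsRootedBinaryTree {t} f =
  Acyclic f × IsRootV f zero × ((v : Fin (suc t)) → Reaches f zero v) ×
  ((v : Fin (suc t)) → v ≡ zero ⊎ IsLeafV f v ⊎ IsInnerTreeV f v)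

IsLeafLabelling : ∀ {n m} → Digraph n → (Fin m → Fin n) → Set
IsLeafLabelling {n} {m} g φ =
  ((a b : Fin m) → φ a ≡ φ b → a ≡ b) ×
  ((v : Fin n) → (IsLeafV g v → ∃ λ a → φ a ≡ v) × ((∃ λ a → φ a ≡ v) → IsLeafV g v))

-- Children / parents; "tree vertex" = out-degree 2 (children j₁ < j₂),
-- "reticulation vertex" = in-degree 2 (parents j¹ < j²).

children : ∀ {n} → Digraph n → Fin n → List (Fin n)
children {n} g j = filterᵇ (λ k → g j k) (allFin n)

parents : ∀ {n} → Digraph n → Fin n → List (Fin n)
parents {n} g j = filterᵇ (λ k → g k j) (allFin n)

pairCase : ∀ {n} → List (Fin n) → (Fin n → Fin n → ℤ) → ℤ
pairCase (a ∷ b ∷ []) h = h a b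
pairCase _            h = + 0

-- Σ over tree vertices v_j of h j j₁ j₂
treeSum : ∀ {n} → Digraph n → (Fin n → Fin n → Fin n → ℤ) → ℤ
treeSum {n} g h = ΣF n (λ j → pairCase (children g j) (h j))

-- Σ over reticulation vertices v_j of h j j¹ j²
retSum : ∀ {n} → Digraph n → (Fin n → Fin n → Fin n → ℤ) → ℤ
retSum {n} g h = ΣF n (λ j → pairCase (parents g j) (h j))

-- The QUBO penalties.  n_T = suc t, tree vertices u_0..u_t : Fin (suc t),
-- u_{n_T} is the extra index (fromℕ (suc t)) of Fin (suc (suc t)).

sBits : ℕ → ℕ → ℕ
sBits nN nT with nN ∸ nT
... | zero  = 0
... | suc k = suc ⌊log₂ (suc k) ⌋

module Penalties {nN t : ℕ} (g : Digraph nN) (f : Digraph (suc t))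
  (x : Fin (suc (suc t)) → Fin nN → Bool)
  (y : Fin t → Fin (sBits nN (suc t)) → Bool)   -- y i' r  stands for  y_{i'+1, r}
  (z ẑ₀ ẑ₁ : Fin (suc t) → Fin nN → Bool)        -- ẑ₀ i j = ẑ_{i,2j}, ẑ₁ i j = ẑ_{i,2j+1}
  where

  nT : ℕ
  nT = suc t

  s : ℕ
  s = sBits nN nT

  X : Fin nT → Fin nN → ℤ
  X i j = bz (x (inject₁ i) j)

  Z Ẑ₀ Ẑ₁ : Fin nT → Fin nN → ℤ
  Z i j = bz (z i j)
  Ẑ₀ i j = bz (ẑ₀ i j)
  Ẑ₁ i j = bz (ẑ₁ i j)

  F : Fin nT → Fin nT → ℤ
  F i l = bz (f i l)

  G : Fin nN → Fin nN → ℤ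
  G j k = bz (g j k)

  isLeafᵇ : Fin nT → Bool
  isLeafᵇ i = (indeg f i ≡ᵇ 1) ∧ (outdeg f i ≡ᵇ 0)

  P1 P2 P3 P4 P5 P6 P7 P8 P9 P11 P12 : ℤ
  P1 = sq (+ 1 - ΣF nN (λ j → X zero j))
     + ΣF t (λ i' → sq (+ 1 - ΣF nN (λ j → X (suc i') j)
                         + ΣF s (λ r → + (2 ^ toℕ r) * bz (y i' r))))
  P2 = ΣF nN (λ j → sq (ΣF (suc nT) (λ i → bz (x i j)) - + 1))
  P3 = ΣF nT (λ i → treeSum g (λ j a b →
         X i a * X i b - + 2 * X i a * Z i j - + 2 * X i b * Z i j + + 3 * Z i j))
  P4 = ΣF nT (λ i → treeSum g (λ j a b → X i j * Z i j))
  P5 = ΣF nT (λ i → retSum g (λ j a b →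
         X i a * X i b - + 2 * X i a * Z i j - + 2 * X i b * Z i j + + 3 * Z i j))
  P6 = ΣF nT (λ i → retSum g (λ j a b → X i j * Z i j))
  P7 = ΣF nT (λ i → ΣF nT (λ l → offDiag i l
         (F i l * treeSum g (λ j a b → X i j * Z l j))))
  P8 = ΣF nT (λ i → if isLeafᵇ i then + 0 else treeSum g (λ j a b →
         X i j * X i a - + 2 * X i j * Ẑ₀ i j - + 2 * X i a * Ẑ₀ i j + + 3 * Ẑ₀ i j
         + (X i j * X i b - + 2 * X i j * Ẑ₁ i j - + 2 * X i b * Ẑ₁ i j + + 3 * Ẑ₁ i j)))
  P9 = ΣF nT (λ i → ΣF nT (λ l → offDiag i l
         (F i l * treeSum g (λ j a b → Ẑ₀ i j * X l b + Ẑ₁ i j * X l a))))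
  P11 = ΣF nT (λ i → ΣF nN (λ j →
          X i j * (+ 1 - ΣF nN (λ k → offDiag j k (G j k * X i k))))) - + nT
  P12 = ΣF nT (λ i → ΣF nT (λ l → offDiag i l
          (F i l * (+ 1 - ΣF nN (λ j → ΣF nN (λ k →
             offDiag j k (G j k * X i j * X l k)))))))

  AllPenaltiesZero : Set
  AllPenaltiesZero =
    P1 ≡ + 0 × P2 ≡ + 0 × P3 ≡ + 0 × P4 ≡ + 0 × P5 ≡ + 0 × P6 ≡ + 0 ×
    P7 ≡ + 0 × P8 ≡ + 0 × P9 ≡ + 0 × P11 ≡ + 0 × P12 ≡ + 0

-- p : Fin (suc len) → vertices is a directed path in g (distinct vertices,
-- consecutive ones joined by edges) whose vertex set is {v | S v = true}.
-- Its terminal vertex is p (fromℕ len).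
IsPathOnSet : ∀ {n} → Digraph n → (Fin n → Bool) → (len : ℕ) → (Fin (suc len) → Fin n) → Set
IsPathOnSet {n} g S len p =
  ((a b : Fin (suc len)) → p a ≡ p b → a ≡ b) ×
  ((k : Fin len) → g (p (inject₁ k)) (p (suc k)) ≡ true) ×
  ((v : Fin n) → (S v ≡ true → ∃ λ k → p k ≡ v) × ((∃ λ k → p k ≡ v) → S v ≡ true))

-- P2 makes the sets d(x,u_i) pairwise disjoint and P1 makes them nonempty.  By P3 and P4 a
-- vertex of d(x,u_i) has at most one out-neighbour in d(x,u_i), and by P3 and P7 at most one
-- in d(x,u_l) when (u_i,u_l) is a tree edge; by P2, P8 and P9 it cannot have out-neighbours in
-- both.  So every edge from d(x,u_i) into d(x,u_l) leaves a sink of the subgraph induced by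
-- d(x,u_i).  Acyclicity gives each d(x,u_i) a sink, and P11 says there are n_T sinks in total,
-- so each d(x,u_i) has exactly one.  Hence there is at most one edge from d(x,u_i) into
-- d(x,u_l), P12 forces at least one, and its tail is the unique sink: the terminal vertex.
module Submission where

open import Data.Bool using (Bool; true; false; if_then_else_; _∧_; T; T?)
open import Data.Bool.Properties using (∧-zeroʳ) renaming (_≟_ to _≟ᵇ_)
open import Data.Empty using (⊥; ⊥-elim)
open import Data.Fin using (Fin; zero; suc; inject₁; fromℕ; toℕ; _≟_)
import Data.Fin.Properties as Finₚ
open import Data.Integer using (ℤ; +_; -[1+_]; 0ℤ; 1ℤ; _+_; _-_; _*_; +≤+)
  renaming (_≤_ to _≤ℤ_)
import Data.Integer.Properties as ℤₚ
open import Data.List using (List; []; _∷_; length; tabulate; filterᵇ)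
open import Data.List.Membership.Propositional using (_∈_)
open import Data.List.Membership.Propositional.Properties using (∈-filter⁺; ∈-allFin)
open import Data.List.Relation.Unary.Any using (here; there)
open import Data.Nat using (ℕ; zero; suc; _≤_; z≤n; s≤s; s≤s⁻¹; _≡ᵇ_)
import Data.Nat as ℕ
import Data.Nat.Properties as ℕₚ
open import Data.Product using (Σ; _×_; ∃; ∃₂; _,_; proj₁; proj₂)
import Data.Product as Product
open import Data.Sum using (_⊎_; inj₁; inj₂)
open import Data.Unit using (tt)
open import Function using (_∘_; id)
open import Relation.Nullary using (¬_; Dec; yes; no; ¬?; _×-dec_; contradiction)
open import Relation.Binary.PropositionalEquality

open import Defs

+-nonneg-zero : ∀ {a b} → 0ℤ ≤ℤ a → 0ℤ ≤ℤ b → a + b ≡ 0ℤ → a ≡ 0ℤ × b ≡ 0ℤ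
+-nonneg-zero (+≤+ {n = zero} _) (+≤+ {n = zero} _) _ = refl , refl
+-nonneg-zero (+≤+ {n = suc _} _) (+≤+ _) ()
+-nonneg-zero (+≤+ {n = zero} _) (+≤+ {n = suc _} _) ()

sq-nonneg : ∀ a → 0ℤ ≤ℤ sq a
sq-nonneg (+ zero)  = +≤+ z≤n
sq-nonneg (+ suc _) = +≤+ z≤n
sq-nonneg -[1+ _ ]  = +≤+ z≤n

sq≡0⇒≡0 : ∀ a → sq a ≡ 0ℤ → a ≡ 0ℤ
sq≡0⇒≡0 (+ zero)  _ = refl
sq≡0⇒≡0 (+ suc _) ()
sq≡0⇒≡0 -[1+ _ ]  ()

ΣF-cong : ∀ n {h h′ : Fin n → ℤ} → (∀ k → h k ≡ h′ k) → ΣF n h ≡ ΣF n h′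
ΣF-cong zero    _   = refl
ΣF-cong (suc n) h≡h′ = cong₂ _+_ (h≡h′ zero) (ΣF-cong n (h≡h′ ∘ suc))

ΣF-nonneg : ∀ n (h : Fin n → ℤ) → (∀ k → 0ℤ ≤ℤ h k) → 0ℤ ≤ℤ ΣF n h
ΣF-nonneg zero    _ _   = +≤+ z≤n
ΣF-nonneg (suc n) h h≥0 = ℤₚ.+-mono-≤ (h≥0 zero) (ΣF-nonneg n (h ∘ suc) (h≥0 ∘ suc))

ΣF-nonneg-zero : ∀ n (h : Fin n → ℤ) → (∀ k → 0ℤ ≤ℤ h k) → ΣF n h ≡ 0ℤ → ∀ k → h k ≡ 0ℤ
ΣF-nonneg-zero (suc n) h h≥0 Σ≡0 zero =
  proj₁ (+-nonneg-zero (h≥0 zero) (ΣF-nonneg n (h ∘ suc) (h≥0 ∘ suc)) Σ≡0)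
ΣF-nonneg-zero (suc n) h h≥0 Σ≡0 (suc k) =
  ΣF-nonneg-zero n (h ∘ suc) (h≥0 ∘ suc)
    (proj₂ (+-nonneg-zero (h≥0 zero) (ΣF-nonneg n (h ∘ suc) (h≥0 ∘ suc)) Σ≡0)) k

pairCase-nonneg : ∀ {n} (L : List (Fin n)) (h : Fin n → Fin n → ℤ) →
  (∀ a b → 0ℤ ≤ℤ h a b) → 0ℤ ≤ℤ pairCase L h
pairCase-nonneg []              _ _   = +≤+ z≤n
pairCase-nonneg (_ ∷ [])        _ _   = +≤+ z≤n
pairCase-nonneg (a ∷ b ∷ [])    _ h≥0 = h≥0 a b
pairCase-nonneg (_ ∷ _ ∷ _ ∷ _) _ _   = +≤+ z≤n

treeSum-nonneg : ∀ {n} (g : Digraph n) (h : Fin n → Fin n → Fin n → ℤ) →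
  (∀ j a b → 0ℤ ≤ℤ h j a b) → 0ℤ ≤ℤ treeSum g h
treeSum-nonneg {n} g h h≥0 = ΣF-nonneg n _ (λ j → pairCase-nonneg (children g j) (h j) (h≥0 j))

treeSum-zero : ∀ {n} (g : Digraph n) (h : Fin n → Fin n → Fin n → ℤ) →
  (∀ j a b → 0ℤ ≤ℤ h j a b) → treeSum g h ≡ 0ℤ →
  ∀ {j a b} → children g j ≡ a ∷ b ∷ [] → h j a b ≡ 0ℤ
treeSum-zero {n} g h h≥0 Σ≡0 {j} ch =
  subst (λ L → pairCase L (h j) ≡ 0ℤ) ch
    (ΣF-nonneg-zero n _ (λ j → pairCase-nonneg (children g j) (h j) (h≥0 j)) Σ≡0 j)

ΣF-treeSum-zero : ∀ {m n} (g : Digraph n) (h : Fin m → Fin n → Fin n → Fin n → ℤ) →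
  (∀ i j a b → 0ℤ ≤ℤ h i j a b) → ΣF m (λ i → treeSum g (h i)) ≡ 0ℤ →
  ∀ i {j a b} → children g j ≡ a ∷ b ∷ [] → h i j a b ≡ 0ℤ
ΣF-treeSum-zero {m} g h h≥0 Σ≡0 i =
  treeSum-zero g (h i) (h≥0 i)
    (ΣF-nonneg-zero m _ (λ i → treeSum-nonneg g (h i) (h≥0 i)) Σ≡0 i)

offDiag≡ : ∀ {n} (j k : Fin n) {w} → (j ≡ k → w ≡ 0ℤ) → offDiag j k w ≡ w
offDiag≡ j k diag with j ≟ k
... | yes j≡k = sym (diag j≡k)
... | no  _   = refl

offDiag-nonneg : ∀ {n} (i l : Fin n) {w} → (i ≢ l → 0ℤ ≤ℤ w) → 0ℤ ≤ℤ offDiag i l w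
offDiag-nonneg i l w≥0 with i ≟ l
... | yes _   = +≤+ z≤n
... | no  i≢l = w≥0 i≢l

bz*-nonneg : ∀ b {w} → (b ≡ true → 0ℤ ≤ℤ w) → 0ℤ ≤ℤ bz b * w
bz*-nonneg false _   = +≤+ z≤n
bz*-nonneg true  w≥0 = subst (0ℤ ≤ℤ_) (sym (ℤₚ.*-identityˡ _)) (w≥0 refl)

-- The shape of P7, P9 and P12: a sum over the edges (u_i,u_l) of the tree.
edgeSum-zero : ∀ {n} (f : Digraph n) (w : Fin n → Fin n → ℤ) →
  (∀ i l → i ≢ l → f i l ≡ true → 0ℤ ≤ℤ w i l) →
  ΣF n (λ i → ΣF n (λ l → offDiag i l (bz (f i l) * w i l))) ≡ 0ℤ →
  ∀ {i l} → i ≢ l → f i l ≡ true → w i l ≡ 0ℤ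
edgeSum-zero {n} f w w≥0 Σ≡0 {i} {l} i≢l fil = begin
  w i l                            ≡⟨ sym (ℤₚ.*-identityˡ (w i l)) ⟩
  bz true * w i l                  ≡⟨ cong (λ b → bz b * w i l) (sym fil) ⟩
  bz (f i l) * w i l               ≡⟨ sym (offDiag≡ i l (⊥-elim ∘ i≢l)) ⟩
  offDiag i l (bz (f i l) * w i l) ≡⟨ ΣF-nonneg-zero n _ (term-nonneg i) row≡0 l ⟩
  0ℤ                               ∎
  where
  open ≡-Reasoning
  term-nonneg : ∀ i l → 0ℤ ≤ℤ offDiag i l (bz (f i l) * w i l)
  term-nonneg i l = offDiag-nonneg i l (λ i≢l → bz*-nonneg (f i l) (w≥0 i l i≢l))
  row≡0 : ΣF n (λ l → offDiag i l (bz (f i l) * w i l)) ≡ 0ℤ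
  row≡0 = ΣF-nonneg-zero n _ (λ i → ΣF-nonneg n _ (term-nonneg i)) Σ≡0 i

∧≡true : ∀ {a b} → a ∧ b ≡ true → a ≡ true × b ≡ true
∧≡true {true} b≡true = refl , b≡true

true∧true≢false : ∀ {a b} → a ≡ true → b ≡ true → a ∧ b ≢ false
true∧true≢false refl refl ()

bz*bz-nonneg : ∀ a b → 0ℤ ≤ℤ bz a * bz b
bz*bz-nonneg false _     = +≤+ z≤n
bz*bz-nonneg true  false = +≤+ z≤n
bz*bz-nonneg true  true  = +≤+ z≤n

bz*bz≡bz∧ : ∀ a b → bz a * bz b ≡ bz (a ∧ b)
bz*bz≡bz∧ false _     = refl
bz*bz≡bz∧ true  false = refl
bz*bz≡bz∧ true  true  = refl

bz*bz≡0 : ∀ a b → bz a * bz b ≡ 0ℤ → a ∧ b ≡ false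
bz*bz≡0 false _     _ = refl
bz*bz≡0 true  false _ = refl
bz*bz≡0 true  true  ()

bz*bz*bz : ∀ a b c → bz a * bz b * bz c ≡ bz (b ∧ a ∧ c)
bz*bz*bz false false _     = refl
bz*bz*bz false true  _     = refl
bz*bz*bz true  false _     = refl
bz*bz*bz true  true  false = refl
bz*bz*bz true  true  true  = refl

+*bz-nonneg : ∀ m b → 0ℤ ≤ℤ + m * bz b
+*bz-nonneg m false = subst (0ℤ ≤ℤ_) (ℤₚ.pos-* m 0) (+≤+ z≤n)
+*bz-nonneg m true  = subst (0ℤ ≤ℤ_) (ℤₚ.pos-* m 1) (+≤+ z≤n)

bz*[1-c] : ∀ a c → (a ≡ true → c ≤ 1) → bz a * (1ℤ - + c) ≡ bz (a ∧ (c ≡ᵇ 0))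
bz*[1-c] false _             _   = refl
bz*[1-c] true  zero          _   = refl
bz*[1-c] true  (suc zero)    _   = refl
bz*[1-c] true  (suc (suc _)) c≤1 with c≤1 refl
... | s≤s ()

gadget : Bool → Bool → Bool → ℤ
gadget a b c = bz a * bz b - + 2 * bz a * bz c - + 2 * bz b * bz c + + 3 * bz c

gadget-nonneg : ∀ a b c → 0ℤ ≤ℤ gadget a b c
gadget-nonneg false false false = +≤+ z≤n
gadget-nonneg false false true  = +≤+ z≤n
gadget-nonneg false true  false = +≤+ z≤n
gadget-nonneg false true  true  = +≤+ z≤n
gadget-nonneg true  false false = +≤+ z≤n
gadget-nonneg true  false true  = +≤+ z≤n
gadget-nonneg true  true  false = +≤+ z≤n
gadget-nonneg true  true  true  = +≤+ z≤n

gadget-zero : ∀ a b c → gadget a b c ≡ 0ℤ → c ≡ a ∧ b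
gadget-zero false false false _ = refl
gadget-zero false true  false _ = refl
gadget-zero true  false false _ = refl
gadget-zero true  true  true  _ = refl
gadget-zero false false true  ()
gadget-zero false true  true  ()
gadget-zero true  false true  ()
gadget-zero true  true  false ()

1-c≡0⇒1≤c : ∀ c → 1ℤ - + c ≡ 0ℤ → 1 ≤ c
1-c≡0⇒1≤c (suc _) _ = s≤s z≤n

1-c+r≡0⇒1≤c : ∀ c {r} → 0ℤ ≤ℤ r → 1ℤ - + c + r ≡ 0ℤ → 1 ≤ c
1-c+r≡0⇒1≤c zero    (+≤+ _) ()
1-c+r≡0⇒1≤c (suc _) _       _ = s≤s z≤n

1-c-nonneg : ∀ c → c ≤ 1 → 0ℤ ≤ℤ 1ℤ - + c
1-c-nonneg zero       _ = +≤+ z≤n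
1-c-nonneg (suc zero) _ = +≤+ z≤n
1-c-nonneg (suc (suc _)) (s≤s ())

ΣF-bz : ∀ n (b : Fin n → Bool) → ΣF n (λ k → bz (b k)) ≡ + count n b
ΣF-bz zero    _ = refl
ΣF-bz (suc n) b rewrite ΣF-bz n (λ k → b (suc k)) with b zero
... | true  = refl
... | false = refl

count-≥1 : ∀ n (b : Fin n → Bool) {k} → b k ≡ true → 1 ≤ count n b
count-≥1 (suc n) b {zero}  bk rewrite bk = s≤s z≤n
count-≥1 (suc n) b {suc _} bk =
  ℕₚ.≤-trans (count-≥1 n (λ k → b (suc k)) bk) (ℕₚ.m≤n+m _ _)

count-≥2 : ∀ n (b : Fin n → Bool) {k k′} → k ≢ k′ → b k ≡ true → b k′ ≡ true → 2 ≤ count n b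
count-≥2 (suc n) b {zero}  {zero}  k≢k′ _  _   = ⊥-elim (k≢k′ refl)
count-≥2 (suc n) b {zero}  {suc _} _    bk bk′ rewrite bk  = s≤s (count-≥1 n _ bk′)
count-≥2 (suc n) b {suc _} {zero}  _    bk bk′ rewrite bk′ = s≤s (count-≥1 n _ bk)
count-≥2 (suc n) b {suc _} {suc _} k≢k′ bk bk′ =
  ℕₚ.≤-trans (count-≥2 n (λ k → b (suc k)) (k≢k′ ∘ cong suc) bk bk′) (ℕₚ.m≤n+m _ _)

count-witness : ∀ n (b : Fin n → Bool) → 1 ≤ count n b → ∃ λ k → b k ≡ true
count-witness (suc n) b 1≤c with b zero in b₀
... | true  = zero , b₀
... | false = Product.map suc id (count-witness n (λ k → b (suc k)) 1≤c)

count-two-witnesses : ∀ n (b : Fin n → Bool) → 2 ≤ count n b →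
  ∃₂ λ k k′ → k ≢ k′ × b k ≡ true × b k′ ≡ true
count-two-witnesses (suc n) b 2≤c with b zero in b₀
... | true  with count-witness n (λ k → b (suc k)) (s≤s⁻¹ 2≤c)
...   | k , bk = zero , suc k , (λ ()) , b₀ , bk
count-two-witnesses (suc n) b 2≤c | false
  with count-two-witnesses n (λ k → b (suc k)) 2≤c
...   | k , k′ , k≢k′ , bk , bk′ = suc k , suc k′ , k≢k′ ∘ Finₚ.suc-injective , bk , bk′

count-zero : ∀ n (b : Fin n → Bool) → (∀ k → b k ≢ true) → count n b ≡ 0
count-zero zero    _ _    = refl
count-zero (suc n) b none with b zero in b₀
... | true  = ⊥-elim (none zero b₀)
... | false = count-zero n (λ k → b (suc k)) (none ∘ suc)

Σℕ : ∀ n → (Fin n → ℕ) → ℕ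
Σℕ zero    _ = 0
Σℕ (suc n) h = h zero ℕ.+ Σℕ n (λ k → h (suc k))

ΣF-+ : ∀ n (h : Fin n → ℕ) → ΣF n (λ k → + h k) ≡ + Σℕ n h
ΣF-+ zero    _ = refl
ΣF-+ (suc n) h = cong (_+_ (+ h zero)) (ΣF-+ n (λ k → h (suc k)))

count≡Σℕ : ∀ n (b : Fin n → Bool) → count n b ≡ Σℕ n (λ k → if b k then 1 else 0)
count≡Σℕ zero    _ = refl
count≡Σℕ (suc n) b = cong ((if b zero then 1 else 0) ℕ.+_) (count≡Σℕ n (λ k → b (suc k)))

Σℕ-mono : ∀ n {h h′ : Fin n → ℕ} → (∀ k → h k ≤ h′ k) → Σℕ n h ≤ Σℕ n h′
Σℕ-mono zero    _    = z≤n
Σℕ-mono (suc n) h≤h′ = ℕₚ.+-mono-≤ (h≤h′ zero) (Σℕ-mono n (h≤h′ ∘ suc))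

Σℕ-witness : ∀ n (h : Fin n → ℕ) → 1 ≤ Σℕ n h → ∃ λ k → 1 ≤ h k
Σℕ-witness (suc n) h 1≤Σ with h zero in h₀
... | suc _ = zero , subst (1 ≤_) (sym h₀) (s≤s z≤n)
... | zero  = Product.map suc id (Σℕ-witness n (λ k → h (suc k)) 1≤Σ)

Σℕ-all≥1 : ∀ n (h : Fin n → ℕ) → (∀ k → 1 ≤ h k) → n ≤ Σℕ n h
Σℕ-all≥1 zero    _ _   = z≤n
Σℕ-all≥1 (suc n) h h≥1 = ℕₚ.+-mono-≤ (h≥1 zero) (Σℕ-all≥1 n (λ k → h (suc k)) (h≥1 ∘ suc))

Σℕ≡n⇒all≡1 : ∀ n (h : Fin n → ℕ) → (∀ k → 1 ≤ h k) → Σℕ n h ≡ n → ∀ k → h k ≡ 1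
Σℕ≡n⇒all≡1 (suc n) h h≥1 Σ≡n = λ
  { zero    → h₀≡1
  ; (suc k) → Σℕ≡n⇒all≡1 n (λ k → h (suc k)) (h≥1 ∘ suc) rest≡n k }
  where
  open ℕₚ.≤-Reasoning
  rest : ℕ
  rest = Σℕ n (λ k → h (suc k))
  h₀≡1 : h zero ≡ 1
  h₀≡1 = ℕₚ.≤-antisym (ℕₚ.+-cancelʳ-≤ n (h zero) 1 (begin
    h zero ℕ.+ n    ≤⟨ ℕₚ.+-monoʳ-≤ (h zero) (Σℕ-all≥1 n _ (h≥1 ∘ suc)) ⟩
    h zero ℕ.+ rest ≡⟨ Σ≡n ⟩
    suc n           ∎)) (h≥1 zero)
  rest≡n : rest ≡ n
  rest≡n = ℕₚ.suc-injective (trans (cong (ℕ._+ rest) (sym h₀≡1)) Σ≡n)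

≤-indicator : ∀ {c d} → (1 ≤ c → d ≡ 0) → c ≤ 1 → c ≤ (if d ≡ᵇ 0 then 1 else 0)
≤-indicator {zero}  _    _   = z≤n
≤-indicator {suc _} c⇒d≡0 c≤1 rewrite c⇒d≡0 (s≤s z≤n) = c≤1

length-filterᵇ-tabulate : ∀ {n m} (f : Fin n → Fin m) (p : Fin m → Bool) →
  length (filterᵇ p (tabulate f)) ≡ count n (λ k → p (f k))
length-filterᵇ-tabulate {zero}  _ _ = refl
length-filterᵇ-tabulate {suc n} f p with p (f zero)
... | true  = cong suc (length-filterᵇ-tabulate (f ∘ suc) p)
... | false = length-filterᵇ-tabulate (f ∘ suc) p

∈-children : ∀ {n} (g : Digraph n) {j k} → g j k ≡ true → k ∈ children g j
∈-children g {j} {k} gjk = ∈-filter⁺ (T? ∘ g j) (∈-allFin k) (subst T (sym gjk) tt)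

two-element-list : ∀ {A : Set} (L : List A) {a b} → a ≢ b → length L ≤ 2 → a ∈ L → b ∈ L →
  L ≡ a ∷ b ∷ [] ⊎ L ≡ b ∷ a ∷ []
two-element-list (_ ∷ [])     a≢b _ (here refl)         (here refl)         = ⊥-elim (a≢b refl)
two-element-list (_ ∷ _ ∷ []) a≢b _ (here refl)         (here refl)         = ⊥-elim (a≢b refl)
two-element-list (_ ∷ _ ∷ []) _   _ (here refl)         (there (here refl)) = inj₁ refl
two-element-list (_ ∷ _ ∷ []) _   _ (there (here refl)) (here refl)         = inj₂ refl
two-element-list (_ ∷ _ ∷ []) a≢b _ (there (here refl)) (there (here refl)) = ⊥-elim (a≢b refl)
two-element-list (_ ∷ _ ∷ _ ∷ _) _ (s≤s (s≤s ())) _ _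

children≡pair : ∀ {n} (g : Digraph n) {j k k′} → outdeg g j ≤ 2 → k ≢ k′ →
  g j k ≡ true → g j k′ ≡ true →
  children g j ≡ k ∷ k′ ∷ [] ⊎ children g j ≡ k′ ∷ k ∷ []
children≡pair g {j} outdeg≤2 k≢k′ gjk gjk′ =
  two-element-list (children g j) k≢k′
    (subst (_≤ 2) (sym (length-filterᵇ-tabulate id (g j))) outdeg≤2)
    (∈-children g gjk) (∈-children g gjk′)

rootedBinaryNetwork-outdeg≤2 : ∀ {n} {g : Digraph n} → IsRootedBinaryNetwork g →
  ∀ j → outdeg g j ≤ 2
rootedBinaryNetwork-outdeg≤2 (_ , _ , (_ , root-out≡2) , _ , kinds) j with kinds j
... | inj₁ refl                   = ℕₚ.≤-reflexive root-out≡2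
... | inj₂ (inj₁ (_ , out≡0))        = ℕₚ.≤-trans (ℕₚ.≤-reflexive out≡0) z≤n
... | inj₂ (inj₂ (inj₁ (_ , out≡2))) = ℕₚ.≤-reflexive out≡2
... | inj₂ (inj₂ (inj₂ (_ , out≡1))) = ℕₚ.≤-trans (ℕₚ.≤-reflexive out≡1) (s≤s z≤n)

acyclic-loopless : ∀ {n} {g : Digraph n} → Acyclic g → ∀ j → g j j ≡ false
acyclic-loopless {g = g} acyclic j with g j j in gjj
... | true  = ⊥-elim (acyclic j (edge gjj))
... | false = refl

IsSinkIn : ∀ {n} → Digraph n → (Fin n → Bool) → Fin n → Set
IsSinkIn g S u = S u ≡ true × ¬ (∃ λ w → S w ≡ true × g u w ≡ true)

module _ {n} {g : Digraph n} {S : Fin n → Bool}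
  (next : ∀ u → S u ≡ true → ∃ λ w → S w ≡ true × g u w ≡ true) where

  private
    walk : Σ (Fin n) (λ u → S u ≡ true) → ℕ → Σ (Fin n) (λ u → S u ≡ true)
    walk start zero    = start
    walk start (suc m) = let (u , Su) = walk start m ; (w , Sw , _) = next u Su in w , Sw

    vertex : Σ (Fin n) (λ u → S u ≡ true) → ℕ → Fin n
    vertex start m = proj₁ (walk start m)

    walk-edge : ∀ start m → g (vertex start m) (vertex start (suc m)) ≡ true
    walk-edge start m = proj₂ (proj₂ (next _ (proj₂ (walk start m))))

    walk-reach : ∀ start m d → Reach⁺ g (vertex start m) (vertex start (suc d ℕ.+ m))
    walk-reach start m zero    = edge (walk-edge start m)
    walk-reach start m (suc d) = cons (walk-edge start m)
      (subst (Reach⁺ g (vertex start (suc m)) ∘ vertex start) (ℕₚ.+-suc (suc d) m)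
        (walk-reach start (suc m) d))

  -- n + 1 steps of a walk inside S must revisit a vertex.
  successor-closed⇒cycle : ∀ {v} → S v ≡ true → ∃ λ u → Reach⁺ g u u
  successor-closed⇒cycle {v} Sv
    with Finₚ.pigeonhole (ℕₚ.n<1+n n) (vertex (v , Sv) ∘ toℕ)
  ... | a , b , a<b , same = _ , subst (Reach⁺ g _) b-th≡a-th (walk-reach (v , Sv) (toℕ a) d)
    where
    d : ℕ
    d = toℕ b ℕ.∸ suc (toℕ a)
    b-th≡a-th : vertex (v , Sv) (suc d ℕ.+ toℕ a) ≡ vertex (v , Sv) (toℕ a)
    b-th≡a-th = trans (cong (vertex (v , Sv))
      (trans (sym (ℕₚ.+-suc d (toℕ a))) (ℕₚ.m∸n+n≡m a<b))) (sym same)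

module _ {n} (g : Digraph n) (S : Fin n → Bool) where

  private
    next? : ∀ u → Dec (∃ λ w → S w ≡ true × g u w ≡ true)
    next? u = Finₚ.any? (λ w → (S w ≟ᵇ true) ×-dec (g u w ≟ᵇ true))

  acyclic⇒sink : Acyclic g → ∀ {v} → S v ≡ true → ∃ (IsSinkIn g S)
  acyclic⇒sink acyclic Sv with Finₚ.any? (λ u → (S u ≟ᵇ true) ×-dec ¬? (next? u))
  ... | yes sink  = sink
  ... | no  ¬sink = ⊥-elim (acyclic _ (proj₂ (successor-closed⇒cycle next Sv)))
    where
    next : ∀ u → S u ≡ true → ∃ λ w → S w ≡ true × g u w ≡ true
    next u Su with next? u
    ... | yes succ  = succ
    ... | no  ¬succ = ⊥-elim (¬sink (u , Su , ¬succ))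

fromℕ-or-inject₁ : ∀ {len} (m : Fin (suc len)) → m ≡ fromℕ len ⊎ ∃ λ m′ → m ≡ inject₁ m′
fromℕ-or-inject₁ {zero}  zero    = inj₁ refl
fromℕ-or-inject₁ {suc _} zero    = inj₂ (zero , refl)
fromℕ-or-inject₁ {suc _} (suc m) with fromℕ-or-inject₁ m
... | inj₁ m≡end       = inj₁ (cong suc m≡end)
... | inj₂ (m′ , m≡m′) = inj₂ (suc m′ , cong suc m≡m′)

pathOnSet-sink≡terminal : ∀ {n len} {g : Digraph n} {S} {p : Fin (suc len) → Fin n} {j} →
  IsPathOnSet g S len p → IsSinkIn g S j → p (fromℕ len) ≡ j
pathOnSet-sink≡terminal {g = g} {p = p} (_ , step , onS) (Sj , no-next) with proj₁ (onS _) Sj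
... | m , pm≡j with fromℕ-or-inject₁ m
...   | inj₁ m≡end     = trans (cong p (sym m≡end)) pm≡j
...   | inj₂ (m′ , refl) =
  ⊥-elim (no-next (p (suc m′) , proj₂ (onS _) (suc m′ , refl) ,
                   subst (λ u → g u (p (suc m′)) ≡ true) pm≡j (step m′)))

module PenaltyConsequences {nN t : ℕ} (g : Digraph nN) (f : Digraph (suc t))
  (x : Fin (suc (suc t)) → Fin nN → Bool)
  (y : Fin t → Fin (sBits nN (suc t)) → Bool)
  (z ẑ₀ ẑ₁ : Fin (suc t) → Fin nN → Bool) where

  open Penalties g f x y z ẑ₀ ẑ₁ using (nT; s; isLeafᵇ; P1; P2; P3; P4; P7; P8; P9; P11; P12)

  -- d(x, u_i); the extra row u_{n_T} of x only enters P2.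
  D : Fin nT → Fin nN → Bool
  D i = x (inject₁ i)

  slack : Fin t → ℤ
  slack i′ = ΣF s (λ r → + (2 ℕ.^ toℕ r) * bz (y i′ r))

  -- P1 is the sum of the squares of these.
  P1-root : Fin nT → ℤ
  P1-root zero     = 1ℤ - ΣF nN (λ j → bz (D zero j))
  P1-root (suc i′) = 1ℤ - ΣF nN (λ j → bz (D (suc i′) j)) + slack i′

  P1≡0⇒nonempty : P1 ≡ 0ℤ → ∀ i → ∃ λ j → D i j ≡ true
  P1≡0⇒nonempty P1≡0 i = count-witness nN (D i) (1≤count i (sq≡0⇒≡0 (P1-root i)
    (ΣF-nonneg-zero nT (sq ∘ P1-root) (sq-nonneg ∘ P1-root) P1≡0 i)))
    where
    1≤count : ∀ i → P1-root i ≡ 0ℤ → 1 ≤ count nN (D i)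
    1≤count zero     root≡0 =
      1-c≡0⇒1≤c _ (subst (λ w → 1ℤ - w ≡ 0ℤ) (ΣF-bz nN (D zero)) root≡0)
    1≤count (suc i′) root≡0 =
      1-c+r≡0⇒1≤c _ (ΣF-nonneg s _ (λ r → +*bz-nonneg (2 ℕ.^ toℕ r) (y i′ r)))
        (subst (λ w → 1ℤ - w + slack i′ ≡ 0ℤ) (ΣF-bz nN (D (suc i′))) root≡0)

  P2≡0⇒disjoint : P2 ≡ 0ℤ → ∀ {i l j} → i ≢ l → D i j ≡ true → D l j ≡ true → ⊥
  P2≡0⇒disjoint P2≡0 {j = j} i≢l Dij Dlj =
    contradiction (subst (2 ≤_) covered-once
      (count-≥2 (suc nT) (λ i → x i j) (i≢l ∘ Finₚ.inject₁-injective) Dij Dlj)) λ { (s≤s ()) }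
    where
    excess : Fin nN → ℤ
    excess j = ΣF (suc nT) (λ i → bz (x i j)) - 1ℤ
    covered-once : count (suc nT) (λ i → x i j) ≡ 1
    covered-once = ℤₚ.+-injective (trans (sym (ΣF-bz (suc nT) (λ i → x i j)))
      (ℤₚ.i-j≡0⇒i≡j _ _ (sq≡0⇒≡0 (excess j)
        (ΣF-nonneg-zero nN (sq ∘ excess) (sq-nonneg ∘ excess) P2≡0 j))))

  P3≡0⇒z≡∧ : P3 ≡ 0ℤ → ∀ i {j a b} → children g j ≡ a ∷ b ∷ [] → z i j ≡ D i a ∧ D i b
  P3≡0⇒z≡∧ P3≡0 i {j} {a} {b} = gadget-zero (D i a) (D i b) (z i j) ∘
    ΣF-treeSum-zero g (λ i j a b → gadget (D i a) (D i b) (z i j))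
      (λ i j a b → gadget-nonneg (D i a) (D i b) (z i j)) P3≡0 i

  P4≡0⇒disjoint-xz : P4 ≡ 0ℤ → ∀ i {j a b} → children g j ≡ a ∷ b ∷ [] → D i j ∧ z i j ≡ false
  P4≡0⇒disjoint-xz P4≡0 i {j} = bz*bz≡0 (D i j) (z i j) ∘
    ΣF-treeSum-zero g (λ i j _ _ → bz (D i j) * bz (z i j))
      (λ i j _ _ → bz*bz-nonneg (D i j) (z i j)) P4≡0 i

  P7≡0⇒disjoint-xz : P7 ≡ 0ℤ → ∀ {i l} → i ≢ l → f i l ≡ true →
    ∀ {j a b} → children g j ≡ a ∷ b ∷ [] → D i j ∧ z l j ≡ false
  P7≡0⇒disjoint-xz P7≡0 {i} {l} i≢l fil {j} = bz*bz≡0 (D i j) (z l j) ∘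
    treeSum-zero g (term i l) (term-nonneg i l)
      (edgeSum-zero f (λ i l → treeSum g (term i l))
        (λ i l _ _ → treeSum-nonneg g (term i l) (term-nonneg i l)) P7≡0 i≢l fil)
    where
    term : Fin nT → Fin nT → Fin nN → Fin nN → Fin nN → ℤ
    term i l j _ _ = bz (D i j) * bz (z l j)
    term-nonneg : ∀ i l j a b → 0ℤ ≤ℤ term i l j a b
    term-nonneg i l j _ _ = bz*bz-nonneg (D i j) (z l j)

  hasChild⇒¬leaf : ∀ {i l} → f i l ≡ true → isLeafᵇ i ≡ false
  hasChild⇒¬leaf {i} fil with outdeg f i | count-≥1 (suc t) (λ w → f i w) fil
  ... | suc _ | _ = ∧-zeroʳ _

  P8≡0⇒ẑ≡∧ : P8 ≡ 0ℤ → ∀ {i} → isLeafᵇ i ≡ false → ∀ {j a b} → children g j ≡ a ∷ b ∷ [] →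
    ẑ₀ i j ≡ D i j ∧ D i a × ẑ₁ i j ≡ D i j ∧ D i b
  P8≡0⇒ẑ≡∧ P8≡0 {i} i-internal {j} {a} {b} ch =
    Product.map (gadget-zero (D i j) (D i a) (ẑ₀ i j)) (gadget-zero (D i j) (D i b) (ẑ₁ i j))
      (+-nonneg-zero (gadget-nonneg (D i j) (D i a) (ẑ₀ i j)) (gadget-nonneg (D i j) (D i b) (ẑ₁ i j))
        (treeSum-zero g (term i) (term-nonneg i) term-sum≡0 ch))
    where
    term : Fin nT → Fin nN → Fin nN → Fin nN → ℤ
    term i j a b = gadget (D i j) (D i a) (ẑ₀ i j) + gadget (D i j) (D i b) (ẑ₁ i j)
    term-nonneg : ∀ i j a b → 0ℤ ≤ℤ term i j a b
    term-nonneg i j a b = ℤₚ.+-mono-≤ (gadget-nonneg (D i j) (D i a) (ẑ₀ i j))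
                                      (gadget-nonneg (D i j) (D i b) (ẑ₁ i j))
    guarded-nonneg : ∀ i → 0ℤ ≤ℤ (if isLeafᵇ i then 0ℤ else treeSum g (term i))
    guarded-nonneg i with isLeafᵇ i
    ... | true  = +≤+ z≤n
    ... | false = treeSum-nonneg g (term i) (term-nonneg i)
    term-sum≡0 : treeSum g (term i) ≡ 0ℤ
    term-sum≡0 = subst (λ c → (if c then 0ℤ else treeSum g (term i)) ≡ 0ℤ) i-internal
      (ΣF-nonneg-zero nT _ guarded-nonneg P8≡0 i)

  P9≡0⇒disjoint-ẑx : P9 ≡ 0ℤ → ∀ {i l} → i ≢ l → f i l ≡ true →
    ∀ {j a b} → children g j ≡ a ∷ b ∷ [] → ẑ₀ i j ∧ D l b ≡ false × ẑ₁ i j ∧ D l a ≡ false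
  P9≡0⇒disjoint-ẑx P9≡0 {i} {l} i≢l fil {j} {a} {b} ch =
    Product.map (bz*bz≡0 (ẑ₀ i j) (D l b)) (bz*bz≡0 (ẑ₁ i j) (D l a))
      (+-nonneg-zero (bz*bz-nonneg (ẑ₀ i j) (D l b)) (bz*bz-nonneg (ẑ₁ i j) (D l a))
        (treeSum-zero g (term i l) (term-nonneg i l)
          (edgeSum-zero f (λ i l → treeSum g (term i l))
            (λ i l _ _ → treeSum-nonneg g (term i l) (term-nonneg i l)) P9≡0 i≢l fil) ch))
    where
    term : Fin nT → Fin nT → Fin nN → Fin nN → Fin nN → ℤ
    term i l j a b = bz (ẑ₀ i j) * bz (D l b) + bz (ẑ₁ i j) * bz (D l a)
    term-nonneg : ∀ i l j a b → 0ℤ ≤ℤ term i l j a b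
    term-nonneg i l j a b =
      ℤₚ.+-mono-≤ (bz*bz-nonneg (ẑ₀ i j) (D l b)) (bz*bz-nonneg (ẑ₁ i j) (D l a))

  module _ (acyclic : Acyclic g) (outdeg≤2 : ∀ j → outdeg g j ≤ 2)
    (P1≡0 : P1 ≡ 0ℤ) (P2≡0 : P2 ≡ 0ℤ) (P3≡0 : P3 ≡ 0ℤ) (P4≡0 : P4 ≡ 0ℤ) (P7≡0 : P7 ≡ 0ℤ)
    (P8≡0 : P8 ≡ 0ℤ) (P9≡0 : P9 ≡ 0ℤ) (P11≡0 : P11 ≡ 0ℤ) (P12≡0 : P12 ≡ 0ℤ) where

    outdegInto : Fin nT → Fin nN → ℕ
    outdegInto l j = count nN (λ k → g j k ∧ D l k)

    outdegInto≤1 : ∀ {l j} → (∀ {a b} → children g j ≡ a ∷ b ∷ [] → z l j ≢ true) →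
      outdegInto l j ≤ 1
    outdegInto≤1 {l} {j} ¬z = ℕₚ.≮⇒≥ (two-successors ∘ count-two-witnesses nN _)
      where
      two-successors : (∃₂ λ k k′ → k ≢ k′ × g j k ∧ D l k ≡ true × g j k′ ∧ D l k′ ≡ true) → ⊥
      two-successors (k , k′ , k≢k′ , e , e′) with ∧≡true e | ∧≡true e′
      ... | gjk , Dlk | gjk′ , Dlk′ with children≡pair g (outdeg≤2 j) k≢k′ gjk gjk′
      ...   | inj₁ ch = ¬z ch (trans (P3≡0⇒z≡∧ P3≡0 l ch) (cong₂ _∧_ Dlk Dlk′))
      ...   | inj₂ ch = ¬z ch (trans (P3≡0⇒z≡∧ P3≡0 l ch) (cong₂ _∧_ Dlk′ Dlk))

    outdegInto-self≤1 : ∀ {i j} → D i j ≡ true → outdegInto i j ≤ 1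
    outdegInto-self≤1 {i} Dij = outdegInto≤1 λ ch zij →
      true∧true≢false Dij zij (P4≡0⇒disjoint-xz P4≡0 i ch)

    outdegInto-child≤1 : ∀ {i l j} → i ≢ l → f i l ≡ true → D i j ≡ true → outdegInto l j ≤ 1
    outdegInto-child≤1 i≢l fil Dij = outdegInto≤1 λ ch zlj →
      true∧true≢false Dij zlj (P7≡0⇒disjoint-xz P7≡0 i≢l fil ch)

    -- By P8 and P9, v_j cannot have one child in d(x,u_i) and the other in d(x,u_l).
    exit⇒outdegInto≡0 : ∀ {i l j} → i ≢ l → f i l ≡ true → D i j ≡ true →
      1 ≤ outdegInto l j → outdegInto i j ≡ 0
    exit⇒outdegInto≡0 {i} {l} {j} i≢l fil Dij 1≤out =
      count-zero nN _ (no-own-successor (count-witness nN _ 1≤out))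
      where
      no-own-successor : (∃ λ b → (g j b ∧ D l b) ≡ true) → ∀ c → (g j c ∧ D i c) ≢ true
      no-own-successor (b , e-b) c e-c with ∧≡true e-b | ∧≡true e-c
      ... | gjb , Dlb | gjc , Dic
        with children≡pair g (outdeg≤2 j) (λ { refl → P2≡0⇒disjoint P2≡0 i≢l Dic Dlb }) gjc gjb
      ...   | inj₁ ch = true∧true≢false
                          (trans (proj₁ (P8≡0⇒ẑ≡∧ P8≡0 (hasChild⇒¬leaf fil) ch)) (cong₂ _∧_ Dij Dic))
                          Dlb (proj₁ (P9≡0⇒disjoint-ẑx P9≡0 i≢l fil ch))
      ...   | inj₂ ch = true∧true≢false
                          (trans (proj₂ (P8≡0⇒ẑ≡∧ P8≡0 (hasChild⇒¬leaf fil) ch)) (cong₂ _∧_ Dij Dic))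
                          Dlb (proj₂ (P9≡0⇒disjoint-ẑx P9≡0 i≢l fil ch))

    isSinkᵇ : Fin nT → Fin nN → Bool
    isSinkᵇ i j = D i j ∧ (outdegInto i j ≡ᵇ 0)

    sinkCount : Fin nT → ℕ
    sinkCount i = count nN (isSinkᵇ i)

    outdegInto≡0⇒sink : ∀ {i j} → D i j ≡ true → outdegInto i j ≡ 0 → IsSinkIn g (D i) j
    outdegInto≡0⇒sink {i} {j} Dij out≡0 = Dij , λ (k , Dik , gjk) →
      contradiction (subst (1 ≤_) out≡0 (count-≥1 nN (λ k → g j k ∧ D i k) (cong₂ _∧_ gjk Dik)))
        λ ()

    sink⇒outdegInto≡0 : ∀ {i j} → IsSinkIn g (D i) j → outdegInto i j ≡ 0
    sink⇒outdegInto≡0 (_ , no-next) = count-zero nN _ λ k e →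
      let (gjk , Dik) = ∧≡true e in no-next (k , Dik , gjk)

    1≤sinkCount : ∀ i → 1 ≤ sinkCount i
    1≤sinkCount i with acyclic⇒sink g (D i) acyclic (proj₂ (P1≡0⇒nonempty P1≡0 i))
    ... | _ , sink = count-≥1 nN (isSinkᵇ i)
      (cong₂ _∧_ (proj₁ sink) (cong (_≡ᵇ 0) (sink⇒outdegInto≡0 sink)))

    offDiag-edge : ∀ j k w → offDiag j k (bz (g j k) * w) ≡ bz (g j k) * w
    offDiag-edge j k w =
      offDiag≡ j k λ { refl → cong (λ b → bz b * w) (acyclic-loopless acyclic j) }

    P11-row : ∀ i →
      ΣF nN (λ j → bz (D i j) * (1ℤ - ΣF nN (λ k → offDiag j k (bz (g j k) * bz (D i k))))) ≡
      + sinkCount i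
    P11-row i = trans (ΣF-cong nN row-term) (ΣF-bz nN (isSinkᵇ i))
      where
      open ≡-Reasoning
      row-term : ∀ j → bz (D i j) * (1ℤ - ΣF nN (λ k → offDiag j k (bz (g j k) * bz (D i k)))) ≡
                       bz (isSinkᵇ i j)
      row-term j = begin
        bz (D i j) * (1ℤ - ΣF nN (λ k → offDiag j k (bz (g j k) * bz (D i k))))
          ≡⟨ cong (λ w → bz (D i j) * (1ℤ - w)) (ΣF-cong nN λ k →
               trans (offDiag-edge j k _) (bz*bz≡bz∧ (g j k) (D i k))) ⟩
        bz (D i j) * (1ℤ - ΣF nN (λ k → bz (g j k ∧ D i k)))
          ≡⟨ cong (λ w → bz (D i j) * (1ℤ - w)) (ΣF-bz nN _) ⟩
        bz (D i j) * (1ℤ - + outdegInto i j)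
          ≡⟨ bz*[1-c] (D i j) (outdegInto i j) outdegInto-self≤1 ⟩
        bz (isSinkᵇ i j) ∎

    sinkCount≡1 : ∀ i → sinkCount i ≡ 1
    sinkCount≡1 = Σℕ≡n⇒all≡1 nT sinkCount 1≤sinkCount (ℤₚ.+-injective
      (trans (sym (ΣF-+ nT sinkCount)) (trans (sym (ΣF-cong nT P11-row)) (ℤₚ.i-j≡0⇒i≡j _ _ P11≡0))))

    edgesFrom : Fin nT → Fin nT → Fin nN → ℕ
    edgesFrom i l j = count nN (λ k → D i j ∧ g j k ∧ D l k)

    edgesBetween : Fin nT → Fin nT → ℕ
    edgesBetween i l = Σℕ nN (edgesFrom i l)

    edgesFrom≤isSink : ∀ {i l} → i ≢ l → f i l ≡ true →
      ∀ j → edgesFrom i l j ≤ (if isSinkᵇ i j then 1 else 0)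
    edgesFrom≤isSink {i} {l} i≢l fil j = bound (D i j) refl
      where
      bound : ∀ a → D i j ≡ a →
        count nN (λ k → a ∧ g j k ∧ D l k) ≤ (if a ∧ (outdegInto i j ≡ᵇ 0) then 1 else 0)
      bound false _   = ℕₚ.≤-reflexive (count-zero nN _ λ _ ())
      bound true  Dij = ≤-indicator (exit⇒outdegInto≡0 i≢l fil Dij) (outdegInto-child≤1 i≢l fil Dij)

    edgesBetween≤1 : ∀ {i l} → i ≢ l → f i l ≡ true → edgesBetween i l ≤ 1
    edgesBetween≤1 {i} {l} i≢l fil = begin
      edgesBetween i l                             ≤⟨ Σℕ-mono nN (edgesFrom≤isSink i≢l fil) ⟩
      Σℕ nN (λ j → if isSinkᵇ i j then 1 else 0)   ≡⟨ sym (count≡Σℕ nN (isSinkᵇ i)) ⟩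
      sinkCount i                                  ≡⟨ sinkCount≡1 i ⟩
      1                                            ∎
      where open ℕₚ.≤-Reasoning

    P12-term : Fin nT → Fin nT → ℤ
    P12-term i l =
      1ℤ - ΣF nN (λ j → ΣF nN (λ k → offDiag j k (bz (g j k) * bz (D i j) * bz (D l k))))

    P12-term≡ : ∀ i l → P12-term i l ≡ 1ℤ - + edgesBetween i l
    P12-term≡ i l = cong (1ℤ -_) (trans
      (ΣF-cong nN λ j → trans (ΣF-cong nN (edge-term j)) (ΣF-bz nN _)) (ΣF-+ nN (edgesFrom i l)))
      where
      edge-term : ∀ j k →
        offDiag j k (bz (g j k) * bz (D i j) * bz (D l k)) ≡ bz (D i j ∧ g j k ∧ D l k)
      edge-term j k = trans
        (offDiag≡ j k λ { refl →
          cong (λ b → bz b * bz (D i j) * bz (D l j)) (acyclic-loopless acyclic j) })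
        (bz*bz*bz (g j k) (D i j) (D l k))

    P12-term-nonneg : ∀ i l → i ≢ l → f i l ≡ true → 0ℤ ≤ℤ P12-term i l
    P12-term-nonneg i l i≢l fil =
      subst (0ℤ ≤ℤ_) (sym (P12-term≡ i l)) (1-c-nonneg _ (edgesBetween≤1 i≢l fil))

    1≤edgesBetween : ∀ {i l} → i ≢ l → f i l ≡ true → 1 ≤ edgesBetween i l
    1≤edgesBetween {i} {l} i≢l fil = 1-c≡0⇒1≤c _
      (trans (sym (P12-term≡ i l)) (edgeSum-zero f P12-term P12-term-nonneg P12≡0 i≢l fil))

    P12≡0⇒edge : ∀ {i l} → i ≢ l → f i l ≡ true →
      ∃₂ λ j k → D i j ≡ true × g j k ≡ true × D l k ≡ true
    P12≡0⇒edge {i} {l} i≢l fil with Σℕ-witness nN (edgesFrom i l) (1≤edgesBetween i≢l fil)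
    ... | j , 1≤edges with count-witness nN _ 1≤edges
    ...   | k , e with ∧≡true e
    ...     | Dij , e′ = j , k , Dij , ∧≡true e′

    terminal-edge : ∀ {i l len} {p : Fin (suc len) → Fin nN} → i ≢ l → f i l ≡ true →
      IsPathOnSet g (D i) len p → ∃ λ k → D l k ≡ true × g (p (fromℕ len)) k ≡ true
    terminal-edge {l = l} {len} {p} i≢l fil path with P12≡0⇒edge i≢l fil
    ... | j , k , Dij , gjk , Dlk = k , Dlk , subst (λ u → g u k ≡ true) (sym end≡j) gjk
      where
      end≡j : p (fromℕ len) ≡ j
      end≡j = pathOnSet-sink≡terminal path (outdegInto≡0⇒sink Dij
        (exit⇒outdegInto≡0 i≢l fil Dij (count-≥1 nN (λ k → g j k ∧ D l k) (cong₂ _∧_ gjk Dlk))))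


corollary15 : (m nN t : ℕ) (g : Digraph nN) (f : Digraph (suc t))
    (φN : Fin m → Fin nN) (φT : Fin m → Fin (suc t)) →
    IsRootedBinaryNetwork g → IsRootedBinaryTree f →
    IsLeafLabelling g φN → IsLeafLabelling f φT →
    suc t ≤ nN →
    (x : Fin (suc (suc t)) → Fin nN → Bool)
    (y : Fin t → Fin (sBits nN (suc t)) → Bool)
    (z ẑ₀ ẑ₁ : Fin (suc t) → Fin nN → Bool) →
    Penalties.AllPenaltiesZero g f x y z ẑ₀ ẑ₁ →
    (i l : Fin (suc t)) → f i l ≡ true →
    (len : ℕ) (p : Fin (suc len) → Fin nN) →
    IsPathOnSet g (x (inject₁ i)) len p →
    ∃ λ k → x (inject₁ l) k ≡ true × g (p (fromℕ len)) k ≡ true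
corollary15 _ _ _ g f _ _ network tree _ _ _ x y z ẑ₀ ẑ₁
  (P1≡0 , P2≡0 , P3≡0 , P4≡0 , _ , _ , P7≡0 , P8≡0 , P9≡0 , P11≡0 , P12≡0) i l fil len p path =
  PenaltyConsequences.terminal-edge g f x y z ẑ₀ ẑ₁
    (proj₁ network) (rootedBinaryNetwork-outdeg≤2 network)
    P1≡0 P2≡0 P3≡0 P4≡0 P7≡0 P8≡0 P9≡0 P11≡0 P12≡0 i≢l fil path
  where
  i≢l : i ≢ l
  i≢l refl = proj₁ tree i (edge fil)
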